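{- The pointwise product of two cobweb tiling sequences need not be a cobweb tiling sequence: there exist cobweb tiling sequences $A=(n_A)_{n\ge0}$ and $B=(n_B)_{n\ge0}$ such that the sequence $C=(n_An_B)_{n\ge0}$ (which is cobweb-admissible) is not a cobweb tiling sequence.
   Context: For a sequence $F=(n_F)_{n\ge0}$ of natural numbers with $0_F=1$, the $F$-nomial coefficient is $\binom{n}{k}_F=\frac{n_F(n-1)_F\cdots(n-k+1)_F}{1_F 2_F\cdots k_F}$ for $0\le k\le n$; $F$ is cobweb-admissible if all these are nonnegative integers. Cobweb poset of $F$: vertices arranged in levels $\Phi_s$, $s\ge0$, with $\Phi_0$ a single vertex and $\Phi_s$ having exactly $s_F$ vertices for $s\ge1$; $x<y$ iff the level of $x$ is strictly smaller than that of $y$. The layer $\langle\Phi_a\rightarrow\Phi_b\rangle$ ($a\le b$) is the subposet induced on $\Phi_a\cup\dots\cup\Phi_b$; its maximal chains are the choices of one vertex from each level. For a layer with $m$ levels, a block $\sigma P_m$ is a subposet induced on $V_a\cup\dots\cup V_b$, $V_i\subseteq\Phi_i$, with $(|V_a|,\dots,|V_b|)=(\sigma(1)_F,\dots,\sigma(m)_F)$ for some permutation $\sigma$ of $\{1,\dots,m\}$ ($\sigma$ may vary between blocks). A partition of the layer into max-disjoint blocks $\sigma P_m$ is a family of such blocks such that every maximal chain of the layer lies in exactly one block. A cobweb tiling sequence is a cobweb-admissible sequence $F$ such that every layer $\langle\Phi_a\rightarrow\Phi_b\rangle$ of its cobweb poset admits such a partition. -}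

module Defs where

open import Data.Nat using (ℕ; zero; suc; _*_; _∸_; _+_; _≤_; _<_)
open import Data.Nat.Divisibility using (_∣_)
open import Data.Fin using (Fin; toℕ)
open import Data.Fin.Subset using (Subset; _∈_; ∣_∣)
open import Data.Fin.Permutation using (Permutation′; _⟨$⟩ʳ_)
open import Data.Product using (Σ; ∃; _×_; ∃!)
open import Relation.Binary.PropositionalEquality using (_≡_)

Seq : Set
Seq = ℕ → ℕ

prod : ℕ → (ℕ → ℕ) → ℕ
prod zero    f = 1
prod (suc k) f = prod k f * f k

fallingF : Seq → ℕ → ℕ → ℕ
fallingF F n k = prod k (λ i → F (n ∸ i))

factF : Seq → ℕ → ℕ
factF F k = prod k (λ i → F (suc i))

-- Cobweb-admissible: 0_F = 1, all terms positive (levels are nonempty,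
-- so the F-nomial quotients are defined), and every F-nomial coefficient
-- is a natural number, i.e. the denominator divides the numerator.
CobwebAdmissible : Seq → Set
CobwebAdmissible F =
  (F 0 ≡ 1) × (∀ n → 0 < F n) ×
  (∀ n k → k ≤ n → factF F k ∣ fallingF F n k)

-- The layer ⟨Φ_a → Φ_b⟩ with m = suc (b ∸ a) levels; level i : Fin m is Φ_{a+i},
-- whose vertices are Fin (F (a + i)).
levels : ℕ → ℕ → ℕ
levels a b = suc (b ∸ a)

Level : Seq → (a b : ℕ) → Fin (levels a b) → Set
Level F a b i = Fin (F (a + toℕ i))

MaxChain : Seq → ℕ → ℕ → Set
MaxChain F a b = (i : Fin (levels a b)) → Level F a b i

-- A block σP_m in the layer: a permutation σ of the m levels and subsets
-- V_i ⊆ Φ_{a+i} with |V_i| = σ(i)_F (σ(i) taken in {1,…,m}).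
record Block (F : Seq) (a b : ℕ) : Set where
  field
    σ    : Permutation′ (levels a b)
    V    : (i : Fin (levels a b)) → Subset (F (a + toℕ i))
    size : ∀ i → ∣ V i ∣ ≡ F (suc (toℕ (σ ⟨$⟩ʳ i)))

_inBlock_ : ∀ {F a b} → MaxChain F a b → Block F a b → Set
c inBlock B = ∀ i → c i ∈ Block.V B i

MaxDisjointPartition : Seq → ℕ → ℕ → Set
MaxDisjointPartition F a b =
  Σ ℕ λ N → Σ (Fin N → Block F a b) λ blocks →
    (c : MaxChain F a b) → ∃! _≡_ (λ j → c inBlock blocks j)

CobwebTiling : Seq → Set
CobwebTiling F =
  CobwebAdmissible F ×
  (∀ a b → 1 ≤ a → a ≤ b → MaxDisjointPartition F a b)

module Submission where

-- The witnesses are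
--     A = 1, 1, 2, 2, 1, 2, 2, 2, …      B = 1, 1, 3, 1, 3, 3, 3, …
-- with pointwise product C = 1, 1, 6, 2, 3, 6, 6, ….
--
-- Call a permutation σ of the m levels Φ_a, …, Φ_{a+m-1}
-- a divisor matching if σ(i)_F divides |Φ_{a+i}| for every i.  Given one,
-- cut each level Φ_{a+i} into chunks of size σ(i)_F; choosing one chunk per
-- level gives a block σP_m, and these blocks partition the maximal chains
-- (a chain lies exactly in the block of the chunks containing its vertices).
-- Taking a = n-k+1 the same matching shows that 1_F ⋯ k_F divides the falling
-- product n_F ⋯ (n-k+1)_F, so it also yields admissibility.  A and B have
-- divisor matchings for every layer, hence are cobweb tiling sequences.
--
-- Admissibility is preserved by pointwise products, so C is
-- admissible.  Every block of the layer ⟨Φ_3 → Φ_4⟩ of C contains a level of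
-- size 2_C = 6, but |Φ_3| = 2 and |Φ_4| = 3.  As the layer has a maximal chain,
-- any partition would contain a block; so C is not a cobweb tiling sequence.

open import Defs
open import Data.Nat using (ℕ; zero; suc; _*_; _+_; _∸_; _≤_; _<_; z≤n; s≤s)
open import Data.Nat.Properties
  using (*-comm; *-assoc; +-suc; +-identityʳ; m∸n+n≡m; <⇒≱; [m*n]*[o*p]≡[m*o]*[n*p]; *-1-commutativeMonoid)
open import Data.Nat.Divisibility using (_∣_; divides; ∣-refl; *-pres-∣; 1∣_; 0∣⇒≡0)
open import Data.Fin using (Fin; toℕ; zero; suc; combine; quotient; remainder; fromℕ<)
open import Data.Fin.Properties using (remQuot-combine; combine-remQuot)
open import Data.Fin.Subset using (Subset; _∈_; ∣_∣; inside; outside; ⊤; ⊥)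
open import Data.Fin.Subset.Properties using (∣p∣≤n; ∣⊤∣≡n; ∣⊥∣≡0)
open import Data.Fin.Permutation using (Permutation′; _⟨$⟩ʳ_; _⟨$⟩ˡ_; id; transpose; inverseʳ)
open import Data.Vec using ([]; _∷_; _++_; lookup)
open import Data.Vec.Properties using (lookup-++ˡ; lookup-++ʳ; lookup-replicate; []=⇒lookup; lookup⇒[]=)
open import Data.Product using (Σ; _×_; _,_; proj₁; proj₂; ∃!)
open import Data.Bool using (true; false)
open import Data.Empty using (⊥-elim)
open import Function using (_∘_)
open import Relation.Binary.PropositionalEquality
  using (_≡_; _≢_; refl; sym; trans; cong; cong₂; subst; subst₂; module ≡-Reasoning)
open import Relation.Nullary using (¬_)
import Algebra.Properties.CommutativeMonoid.Sum as MonoidSum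

open MonoidSum *-1-commutativeMonoid using (sum-permute) renaming (sum to ∏)
open ≡-Reasoning

∏-∣ : ∀ {m} (f g : Fin m → ℕ) → (∀ i → f i ∣ g i) → ∏ f ∣ ∏ g
∏-∣ {zero}  f g f∣g = ∣-refl
∏-∣ {suc m} f g f∣g = *-pres-∣ (f∣g zero) (∏-∣ (f ∘ suc) (g ∘ suc) (f∣g ∘ suc))

prod-suc : ∀ k (g : ℕ → ℕ) → prod (suc k) g ≡ g 0 * prod k (g ∘ suc)
prod-suc zero    g = *-comm 1 (g 0)
prod-suc (suc k) g = begin
  prod (suc k) g * g (suc k)          ≡⟨ cong (_* g (suc k)) (prod-suc k g) ⟩
  g 0 * prod k (g ∘ suc) * g (suc k)  ≡⟨ *-assoc (g 0) _ _ ⟩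
  g 0 * prod (suc k) (g ∘ suc)        ∎

prod≡∏ : ∀ k (g : ℕ → ℕ) → prod k g ≡ ∏ {k} (g ∘ toℕ)
prod≡∏ zero    g = refl
prod≡∏ (suc k) g = trans (prod-suc k g) (cong (g 0 *_) (prod≡∏ k (g ∘ suc)))

prod-* : ∀ k (f g : ℕ → ℕ) → prod k (λ i → f i * g i) ≡ prod k f * prod k g
prod-* zero    f g = refl
prod-* (suc k) f g = begin
  prod k (λ i → f i * g i) * (f k * g k)  ≡⟨ cong (_* (f k * g k)) (prod-* k f g) ⟩
  prod k f * prod k g * (f k * g k)       ≡⟨ [m*n]*[o*p]≡[m*o]*[n*p] (prod k f) _ _ _ ⟩
  prod k f * f k * (prod k g * g k)       ∎

fallingF-levels : ∀ F d k → fallingF F (d + k) k ≡ prod k (λ i → F (suc d + i))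
fallingF-levels F d zero = refl
fallingF-levels F d (suc k) rewrite +-suc d k = begin
  prod (suc k) (λ i → F (suc (d + k) ∸ i))        ≡⟨ prod-suc k _ ⟩
  F (suc (d + k)) * fallingF F (d + k) k          ≡⟨ cong (F (suc (d + k)) *_) (fallingF-levels F d k) ⟩
  F (suc (d + k)) * prod k (λ i → F (suc d + i))  ≡⟨ *-comm (F (suc (d + k))) _ ⟩
  prod k (λ i → F (suc d + i)) * F (suc d + k)    ∎

DivisorMatching : Seq → ℕ → ℕ → Set
DivisorMatching F a m =
  Σ (Permutation′ m) λ σ → ∀ i → F (suc (toℕ (σ ⟨$⟩ʳ i))) ∣ F (a + toℕ i)

-- Divisor matchings at all levels a ≥ 1 make every F-nomial coefficient
-- integral: 1_F ⋯ k_F = ∏ σ(i)_F divides ∏ |Φ_{n-k+1+i}| = n_F ⋯ (n-k+1)_F.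
matching⇒F-nomial : ∀ F → (∀ a m → 1 ≤ a → DivisorMatching F a m) →
                    ∀ n k → k ≤ n → factF F k ∣ fallingF F n k
matching⇒F-nomial F matching n k k≤n = subst₂ _∣_ (sym factorial) (sym falling) (∏-∣ _ _ σ-divides)
  where
  d : ℕ
  d = n ∸ k
  σ : Permutation′ k
  σ = proj₁ (matching (suc d) k (s≤s z≤n))
  σ-divides : ∀ i → F (suc (toℕ (σ ⟨$⟩ʳ i))) ∣ F (suc d + toℕ i)
  σ-divides = proj₂ (matching (suc d) k (s≤s z≤n))
  factorial : factF F k ≡ ∏ {k} (λ i → F (suc (toℕ (σ ⟨$⟩ʳ i))))
  factorial = trans (prod≡∏ k (F ∘ suc)) (sum-permute (F ∘ suc ∘ toℕ) σ)
  falling : fallingF F n k ≡ ∏ {k} (λ i → F (suc d + toℕ i))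
  falling = begin
    fallingF F n k                   ≡⟨ cong (λ n′ → fallingF F n′ k) (sym (m∸n+n≡m k≤n)) ⟩
    fallingF F (d + k) k             ≡⟨ fallingF-levels F d k ⟩
    prod k (λ i → F (suc d + i))     ≡⟨ prod≡∏ k (λ i → F (suc d + i)) ⟩
    ∏ {k} (λ i → F (suc d + toℕ i))  ∎

∣++∣ : ∀ {k l} (u : Subset k) (v : Subset l) → ∣ u ++ v ∣ ≡ ∣ u ∣ + ∣ v ∣
∣++∣ []          v = refl
∣++∣ (true ∷ u)  v = cong suc (∣++∣ u v)
∣++∣ (false ∷ u) v = ∣++∣ u v

∉⊥ : ∀ {n} (x : Fin n) → lookup (⊥ {n}) x ≢ inside
∉⊥ x x∈⊥ with trans (sym (lookup-replicate x outside)) x∈⊥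
... | ()

-- segment q s g: the g-th of q consecutive segments of length s in Fin (q * s),
-- i.e. the elements combine g j.
segment : ∀ q s → Fin q → Subset (q * s)
segment (suc q) s zero    = ⊤ {s} ++ ⊥ {q * s}
segment (suc q) s (suc g) = ⊥ {s} ++ segment q s g

segment-size : ∀ q s g → ∣ segment q s g ∣ ≡ s
segment-size (suc q) s zero = begin
  ∣ ⊤ {s} ++ ⊥ {q * s} ∣     ≡⟨ ∣++∣ (⊤ {s}) (⊥ {q * s}) ⟩
  ∣ ⊤ {s} ∣ + ∣ ⊥ {q * s} ∣  ≡⟨ cong₂ _+_ (∣⊤∣≡n s) (∣⊥∣≡0 (q * s)) ⟩
  s + 0                      ≡⟨ +-identityʳ s ⟩
  s                          ∎
segment-size (suc q) s (suc g) = trans (∣++∣ (⊥ {s}) (segment q s g)) (cong₂ _+_ (∣⊥∣≡0 s) (segment-size q s g))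

segment-own : ∀ q s (g : Fin q) (j : Fin s) → lookup (segment q s g) (combine g j) ≡ inside
segment-own (suc q) s zero    j = trans (lookup-++ˡ (⊤ {s}) (⊥ {q * s}) j) (lookup-replicate j inside)
segment-own (suc q) s (suc g) j = trans (lookup-++ʳ (⊥ {s}) _ (combine g j)) (segment-own q s g j)

segment-only : ∀ q s (g h : Fin q) (j : Fin s) →
               lookup (segment q s g) (combine h j) ≡ inside → h ≡ g
segment-only (suc q) s zero    zero    j _ = refl
segment-only (suc q) s zero    (suc h) j e =
  ⊥-elim (∉⊥ (combine h j) (trans (sym (lookup-++ʳ (⊤ {s}) (⊥ {q * s}) (combine h j))) e))
segment-only (suc q) s (suc g) zero    j e =
  ⊥-elim (∉⊥ j (trans (sym (lookup-++ˡ (⊥ {s}) (segment q s g) j)) e))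
segment-only (suc q) s (suc g) (suc h) j e =
  cong suc (segment-only q s g h j (trans (sym (lookup-++ʳ (⊥ {s}) _ (combine h j))) e))

record ChunkPartition (n s : ℕ) : Set where
  field
    count      : ℕ
    chunk      : Fin count → Subset n
    chunkOf    : Fin n → Fin count
    chunk-size : ∀ g → ∣ chunk g ∣ ≡ s
    ∈-chunkOf  : ∀ x → x ∈ chunk (chunkOf x)
    ∈⇒chunkOf  : ∀ x g → x ∈ chunk g → chunkOf x ≡ g

-- If s divides n, then Fin n = Fin (q * s) is partitioned into the q segments;
-- x lies in segment (quotient x) since x = combine (quotient x) (remainder x).
chunkPartition : ∀ {n s} → s ∣ n → ChunkPartition n s
chunkPartition {s = s} (divides q refl) = record
  { count      = q
  ; chunk      = segment q s
  ; chunkOf    = quotient s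
  ; chunk-size = segment-size q s
  ; ∈-chunkOf  = λ x → lookup⇒[]= x _
                   (subst (inSegment (quotient s x)) (recombine x) (segment-own q s _ _))
  ; ∈⇒chunkOf  = λ x g x∈g → segment-only q s g _ _
                   (subst (inSegment g) (sym (recombine x)) ([]=⇒lookup x∈g))
  }
  where
  inSegment : Fin q → Fin (q * s) → Set
  inSegment g x = lookup (segment q s g) x ≡ inside
  recombine : ∀ x → combine (quotient {q} s x) (remainder {q} s x) ≡ x
  recombine = combine-remQuot {q} s

-- Mixed-radix numbering: Fin (∏ q) is in bijection with the tuples
-- (t i : Fin (q i))_{i < m}; encode is the numbering, decode its inverse.
encode : ∀ {m} (q : Fin m → ℕ) → ((i : Fin m) → Fin (q i)) → Fin (∏ q)
encode {zero}  q t = zero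
encode {suc m} q t = combine (t zero) (encode (q ∘ suc) (t ∘ suc))

decode : ∀ {m} (q : Fin m → ℕ) → Fin (∏ q) → (i : Fin m) → Fin (q i)
decode {suc m} q j zero    = quotient (∏ (q ∘ suc)) j
decode {suc m} q j (suc i) = decode (q ∘ suc) (remainder {q zero} (∏ (q ∘ suc)) j) i

decode-encode : ∀ {m} (q : Fin m → ℕ) t i → decode q (encode q t) i ≡ t i
decode-encode {suc m} q t zero = cong proj₁ (remQuot-combine (t zero) (encode (q ∘ suc) (t ∘ suc)))
decode-encode {suc m} q t (suc i) = begin
  decode (q ∘ suc) (remainder {q zero} (∏ (q ∘ suc)) (encode q t)) i
    ≡⟨ cong (λ r → decode (q ∘ suc) r i) (cong proj₂ (remQuot-combine (t zero) (encode (q ∘ suc) (t ∘ suc)))) ⟩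
  decode (q ∘ suc) (encode (q ∘ suc) (t ∘ suc)) i
    ≡⟨ decode-encode (q ∘ suc) (t ∘ suc) i ⟩
  t (suc i) ∎

encode-unique : ∀ {m} (q : Fin m → ℕ) j t → (∀ i → decode q j i ≡ t i) → j ≡ encode q t
encode-unique {zero}  q zero t _ = refl
encode-unique {suc m} q j    t j↦t = begin
  j                                                        ≡⟨ combine-remQuot {q zero} (∏ (q ∘ suc)) j ⟨
  combine (decode q j zero) (remainder {q zero} (∏ (q ∘ suc)) j)
    ≡⟨ cong₂ combine (j↦t zero) (encode-unique (q ∘ suc) _ (t ∘ suc) (j↦t ∘ suc)) ⟩
  encode q t                                               ∎

-- Cut each level into chunks of size σ(i)_F; block j
-- takes chunk (decode j i) in level i, and a chain c lies exactly in the block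
-- numbered by the chunks containing its vertices.
matching⇒partition : ∀ F a b → DivisorMatching F a (levels a b) → MaxDisjointPartition F a b
matching⇒partition F a b (σ , σ-divides) = ∏ count′ , block , unique-block
  where
  open ChunkPartition
  P : ∀ i → ChunkPartition (F (a + toℕ i)) (F (suc (toℕ (σ ⟨$⟩ʳ i))))
  P i = chunkPartition (σ-divides i)
  count′ : Fin (levels a b) → ℕ
  count′ i = count (P i)
  block : Fin (∏ count′) → Block F a b
  block j = record { σ = σ ; V = λ i → chunk (P i) (decode count′ j i) ; size = λ i → chunk-size (P i) _ }
  unique-block : (c : MaxChain F a b) → ∃! _≡_ (λ j → c inBlock block j)
  unique-block c = encode count′ t , c∈block ,
                   λ c∈j → sym (encode-unique count′ _ t (λ i → sym (∈⇒chunkOf (P i) (c i) _ (c∈j i))))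
    where
    t : ∀ i → Fin (count′ i)
    t i = chunkOf (P i) (c i)
    c∈block : c inBlock block (encode count′ t)
    c∈block i = subst (λ g → c i ∈ chunk (P i) g) (sym (decode-encode count′ t i)) (∈-chunkOf (P i) (c i))

tiling-criterion : ∀ F → F 0 ≡ 1 → (∀ n → 0 < F n) →
                   (∀ a m → 1 ≤ a → DivisorMatching F a m) → CobwebTiling F
tiling-criterion F F0≡1 positive matching =
  (F0≡1 , positive , matching⇒F-nomial F matching) ,
  λ a b 1≤a _ → matching⇒partition F a b (matching a (levels a b) 1≤a)

0<* : ∀ {m n} → 0 < m → 0 < n → 0 < m * n
0<* (s≤s z≤n) (s≤s z≤n) = s≤s z≤n

-- Pointwise products of cobweb-admissible sequences are cobweb-admissible:
-- both numerator and denominator of the F-nomial coefficient are multiplicative.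
admissible-* : ∀ F G → CobwebAdmissible F → CobwebAdmissible G →
               CobwebAdmissible (λ n → F n * G n)
admissible-* F G (F0≡1 , F-positive , F-nomial) (G0≡1 , G-positive , G-nomial) =
  cong₂ _*_ F0≡1 G0≡1 ,
  (λ n → 0<* (F-positive n) (G-positive n)) ,
  λ n k k≤n → subst₂ _∣_ (sym (prod-* k _ _)) (sym (prod-* k _ _))
                        (*-pres-∣ (F-nomial n k k≤n) (G-nomial n k k≤n))

-- Every block σP_m of a layer contains, for each k ∈ {1, …, m}, the level
-- σ⁻¹(k), whose chosen subset has k_F elements; so that level has ≥ k_F vertices.
block-level-size : ∀ {F a b} (B : Block F a b) (k : Fin (levels a b)) →
                   F (suc (toℕ k)) ≤ F (a + toℕ (Block.σ B ⟨$⟩ˡ k))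
block-level-size {F} {a} B k = subst (_≤ F (a + toℕ (σ ⟨$⟩ˡ k))) size-is-k (∣p∣≤n (V (σ ⟨$⟩ˡ k)))
  where
  open Block B
  size-is-k : ∣ V (σ ⟨$⟩ˡ k) ∣ ≡ F (suc (toℕ k))
  size-is-k = trans (size (σ ⟨$⟩ˡ k)) (cong (λ i → F (suc (toℕ i))) (inverseʳ σ))

-- If all levels are nonempty, a layer has a maximal chain, so any partition of
-- it into max-disjoint blocks contains at least one block.
partition⇒block : ∀ {F a b} → (∀ n → 0 < F n) → MaxDisjointPartition F a b → Block F a b
partition⇒block {F} {a} positive (_ , block , unique-block) = block (proj₁ (unique-block firstChain))
  where
  firstChain : MaxChain F a _
  firstChain i = fromℕ< (positive (a + toℕ i))

divisor-positive : ∀ {d n} → d ∣ suc n → 0 < d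
divisor-positive {zero}  0∣n with 0∣⇒≡0 0∣n
... | ()
divisor-positive {suc d} _ = s≤s z≤n

A : Seq
A 0 = 1
A 1 = 1
A 2 = 2
A 3 = 2
A 4 = 1
A (suc (suc (suc (suc (suc n))))) = 2

B : Seq
B 0 = 1
B 1 = 1
B 2 = 3
B 3 = 1
B (suc (suc (suc (suc n)))) = 3

A∣2 : ∀ n → A n ∣ 2
A∣2 0 = 1∣ 2
A∣2 1 = 1∣ 2
A∣2 2 = ∣-refl
A∣2 3 = ∣-refl
A∣2 4 = 1∣ 2
A∣2 (suc (suc (suc (suc (suc n))))) = ∣-refl

B∣3 : ∀ n → B n ∣ 3
B∣3 0 = 1∣ 3
B∣3 1 = 1∣ 3
B∣3 2 = ∣-refl
B∣3 3 = 1∣ 3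
B∣3 (suc (suc (suc (suc n)))) = ∣-refl

-- Beyond the first few levels every level has size 2
-- (or size 1 at level 4, matched with 1_A = 1), so the identity works; starting
-- at levels 2 and 3 the value 1_A = 1 must be moved onto the level 4.
A-matching : ∀ a m → 1 ≤ a → DivisorMatching A a m
A-matching 1 m _ = id , λ i → ∣-refl
A-matching 2 0 _ = id , λ ()
A-matching 2 1 _ = id , λ { zero → 1∣ _ }
A-matching 2 2 _ = id , λ { zero → 1∣ _ ; (suc zero) → ∣-refl }
A-matching 2 (suc (suc (suc m))) _ = transpose zero (suc (suc zero)) ,
  λ { zero → ∣-refl ; (suc zero) → ∣-refl ; (suc (suc zero)) → 1∣ _ ; (suc (suc (suc i))) → A∣2 _ }
A-matching 3 0 _ = id , λ ()
A-matching 3 1 _ = id , λ { zero → 1∣ _ }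
A-matching 3 (suc (suc m)) _ = transpose zero (suc zero) ,
  λ { zero → ∣-refl ; (suc zero) → 1∣ _ ; (suc (suc i)) → A∣2 _ }
A-matching 4 m _ = id , λ { zero → 1∣ _ ; (suc i) → A∣2 _ }
A-matching (suc (suc (suc (suc (suc a))))) m _ = id , λ i → A∣2 _

-- Divisor matchings for B: only starting at level 2 is 1_B = 1 moved, onto level 3.
B-matching : ∀ a m → 1 ≤ a → DivisorMatching B a m
B-matching 1 m _ = id , λ i → ∣-refl
B-matching 2 0 _ = id , λ ()
B-matching 2 1 _ = id , λ { zero → 1∣ _ }
B-matching 2 (suc (suc m)) _ = transpose zero (suc zero) ,
  λ { zero → ∣-refl ; (suc zero) → 1∣ _ ; (suc (suc i)) → B∣3 _ }
B-matching 3 m _ = id , λ { zero → 1∣ _ ; (suc i) → B∣3 _ }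
B-matching (suc (suc (suc (suc a)))) m _ = id , λ i → B∣3 _

A-tiling : CobwebTiling A
A-tiling = tiling-criterion A refl (divisor-positive ∘ A∣2) A-matching

B-tiling : CobwebTiling B
B-tiling = tiling-criterion B refl (divisor-positive ∘ B∣3) B-matching

C : Seq
C n = A n * B n

C-layer-3-4-small : ∀ (i : Fin 2) → C (3 + toℕ i) < C 2
C-layer-3-4-small zero       = s≤s (s≤s (s≤s z≤n))
C-layer-3-4-small (suc zero) = s≤s (s≤s (s≤s (s≤s z≤n)))

C-not-tiling : ¬ CobwebTiling C
C-not-tiling ((_ , C-positive , _) , partition) =
  <⇒≱ (C-layer-3-4-small (Block.σ block ⟨$⟩ˡ suc zero)) (block-level-size block (suc zero))
  where
  block : Block C 3 4
  block = partition⇒block C-positive (partition 3 4 (s≤s z≤n) (s≤s (s≤s (s≤s z≤n))))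

mainTheorem4 : Σ Seq λ A → Σ Seq λ B →
    CobwebTiling A × CobwebTiling B ×
    CobwebAdmissible (λ n → A n * B n) × ¬ CobwebTiling (λ n → A n * B n)
mainTheorem4 =
  A , B , A-tiling , B-tiling ,
  admissible-* A B (proj₁ A-tiling) (proj₁ B-tiling) , C-not-tiling
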